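{- Let $D$ be a positive integer and define, for $1\le i\le D$ and $0\le i\le D$ respectively, $c_i=\frac{3(D-i+1)i(D+i+1)}{D(D+2)(2i+1)}$, $a_i=\frac{3i(i+1)}{D(D+2)}$, $b_i=\frac{3(D-i)(i+1)(D+i+2)}{D(D+2)(2i+1)}$ (for $0\le i\le D-1$), and $\theta_i=3-2a_i$ ($0\le i\le D$). Let $u_0(\lambda),\dots,u_D(\lambda)\in\mathbb R[\lambda]$ be defined by $u_0=1$, $u_1=\lambda/3$, and $\lambda u_i(\lambda)=b_iu_{i+1}(\lambda)+a_iu_i(\lambda)+c_iu_{i-1}(\lambda)$ for $1\le i\le D-1$. Then: (i) $u_i(\theta_j)=u_j(\theta_i)$ for $0\le i,j\le D$; (ii) $u_i(\theta_0)=1$ for $0\le i\le D$; (iii) $u_0(\theta_j)=1$ for $0\le j\le D$. -}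

module Defs where

open import Data.Nat as ℕ using (ℕ; suc; _∸_; NonZero)
open import Data.Nat.Properties using (m*n≢0)
open import Data.Integer using (+_)
open import Data.Rational using (ℚ; _/_; _-_; _*_)

den : (D i : ℕ) → .{{NonZero D}} → ℕ
den D i = (D ℕ.* (2 ℕ.+ D)) ℕ.* suc (2 ℕ.* i)

den≢0 : (D i : ℕ) → .{{_ : NonZero D}} → NonZero (den D i)
den≢0 D i = m*n≢0 (D ℕ.* (2 ℕ.+ D)) (suc (2 ℕ.* i)) {{m*n≢0 D (2 ℕ.+ D)}}

c : (D : ℕ) → .{{NonZero D}} → ℕ → ℚ
c D i = _/_ (+ (3 ℕ.* ((D ∸ i) ℕ.+ 1) ℕ.* i ℕ.* (D ℕ.+ i ℕ.+ 1))) (den D i) {{den≢0 D i}}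

a : (D : ℕ) → .{{NonZero D}} → ℕ → ℚ
a D i = _/_ (+ (3 ℕ.* i ℕ.* (i ℕ.+ 1))) (D ℕ.* (2 ℕ.+ D)) {{m*n≢0 D (2 ℕ.+ D)}}

b : (D : ℕ) → .{{NonZero D}} → ℕ → ℚ
b D i = _/_ (+ (3 ℕ.* (D ∸ i) ℕ.* (i ℕ.+ 1) ℕ.* (D ℕ.+ i ℕ.+ 2))) (den D i) {{den≢0 D i}}

θ : (D : ℕ) → .{{NonZero D}} → ℕ → ℚ
θ D i = (+ 3 / 1) - ((+ 2 / 1) * a D i)

-- The u_i are determined by u_0, u_1 and the recurrence, because b_i ≠ 0 for i < D. So it suffices to
-- exhibit a solution: the terminating hypergeometric sum
--   F(i, j) = Σ_{n ≤ D} w_n (−i)_n (i+1)_n (−j)_n (j+1)_n,   w_n = Π_{k<n} (−1 / ρ_k),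
--   ρ_k = (k+1)² (D−k) (D+k+2),
-- which is visibly symmetric in i and j, equals 1 at i = 0 and θ_j/3 at i = 1. It satisfies the recurrence
-- in i at λ = θ_j because a contiguous relation for (−x)_n (x+1)_n makes the defect of the recurrence on the
-- partial sums telescope to a multiple of (−j)_{D+1}, which vanishes for j ≤ D. Hence u_i(θ_j) = F(i, j).
module Submission where

open import Defs
open import Data.Nat using (ℕ; zero; suc; _∸_; _≤_; _<_; NonZero; z≤n; s≤s; s≤s⁻¹)
import Data.Nat as ℕ
import Data.Nat.Properties as ℕ
open import Data.Integer using (+_)
import Data.Integer as ℤ
import Data.Integer.Properties as ℤ
open import Data.Rational using (ℚ; _/_; _+_; _*_; _-_; -_; 1/_; 1ℚ; 0ℚ; toℚᵘ; fromℚᵘ)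
import Data.Rational as ℚ
open import Data.Rational.Properties
  using ( +-*-commutativeRing; _≟_; toℚᵘ-injective; toℚᵘ-fromℚᵘ; toℚᵘ-homo-+; toℚᵘ-homo-*; fromℚᵘ-cong
        ; +-comm; +-inverseˡ; +-0-group; *-assoc; *-identityˡ; *-identityʳ; *-zeroˡ; *-zeroʳ; *-inverseˡ
        ; *-1-commutativeMonoid; normalize-pos; pos⇒nonZero )
import Data.Rational.Unnormalised as ℚᵘ
import Data.Rational.Unnormalised.Properties as ℚᵘ
open import Data.Product using (_×_; _,_; proj₁; proj₂)
open import Data.Sum using (inj₁; inj₂)
open import Algebra.Bundles using (CommutativeMonoid)
open import Algebra.Properties.Group +-0-group using (∙-cancelʳ)
open import Algebra.Properties.CommutativeSemigroup (CommutativeMonoid.commutativeSemigroup *-1-commutativeMonoid)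
  using (xy∙z≈xz∙y)
open import Level using (0ℓ)
open import Relation.Nullary.Decidable using (dec⇒maybe)
open import Relation.Binary.PropositionalEquality
open import Tactic.RingSolver using (solve-∀)
open import Tactic.RingSolver.Core.AlmostCommutativeRing using (AlmostCommutativeRing; fromCommutativeRing)

ℚ-ring : AlmostCommutativeRing 0ℓ 0ℓ
ℚ-ring = fromCommutativeRing +-*-commutativeRing (λ p → dec⇒maybe (0ℚ ≟ p))

2ℚ 3ℚ 6ℚ : ℚ
2ℚ = + 2 / 1
3ℚ = + 3 / 1
6ℚ = + 6 / 1

fromℚᵘ-homo-+ : ∀ p q → fromℚᵘ (p ℚᵘ.+ q) ≡ fromℚᵘ p + fromℚᵘ q
fromℚᵘ-homo-+ p q = toℚᵘ-injective (begin
  toℚᵘ (fromℚᵘ (p ℚᵘ.+ q))               ≈⟨ toℚᵘ-fromℚᵘ (p ℚᵘ.+ q) ⟩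
  p ℚᵘ.+ q                               ≈⟨ ℚᵘ.+-cong (toℚᵘ-fromℚᵘ p) (toℚᵘ-fromℚᵘ q) ⟨
  toℚᵘ (fromℚᵘ p) ℚᵘ.+ toℚᵘ (fromℚᵘ q)   ≈⟨ toℚᵘ-homo-+ (fromℚᵘ p) (fromℚᵘ q) ⟨
  toℚᵘ (fromℚᵘ p + fromℚᵘ q)             ∎)
  where open ℚᵘ.≃-Reasoning

fromℚᵘ-homo-* : ∀ p q → fromℚᵘ (p ℚᵘ.* q) ≡ fromℚᵘ p * fromℚᵘ q
fromℚᵘ-homo-* p q = toℚᵘ-injective (begin
  toℚᵘ (fromℚᵘ (p ℚᵘ.* q))               ≈⟨ toℚᵘ-fromℚᵘ (p ℚᵘ.* q) ⟩
  p ℚᵘ.* q                               ≈⟨ ℚᵘ.*-cong (toℚᵘ-fromℚᵘ p) (toℚᵘ-fromℚᵘ q) ⟨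
  toℚᵘ (fromℚᵘ p) ℚᵘ.* toℚᵘ (fromℚᵘ q)   ≈⟨ toℚᵘ-homo-* (fromℚᵘ p) (fromℚᵘ q) ⟨
  toℚᵘ (fromℚᵘ p * fromℚᵘ q)             ∎)
  where open ℚᵘ.≃-Reasoning

fromℕ : ℕ → ℚ
fromℕ n = + n / 1

1/ℕ : ℕ → ℚ
1/ℕ zero        = 0ℚ
1/ℕ n@(suc _)   = + 1 / n

fromℕ-+ : ∀ m n → fromℕ (m ℕ.+ n) ≡ fromℕ m + fromℕ n
fromℕ-+ m n = trans
  (fromℚᵘ-cong {ℚᵘ.mkℚᵘ (+ (m ℕ.+ n)) 0} {ℚᵘ.mkℚᵘ (+ m) 0 ℚᵘ.+ ℚᵘ.mkℚᵘ (+ n) 0} (ℚᵘ.*≡* (begin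
    + (m ℕ.+ n) ℤ.* + 1                   ≡⟨ ℤ.*-identityʳ _ ⟩
    + (m ℕ.+ n)                           ≡⟨ ℤ.pos-+ m n ⟩
    + m ℤ.+ + n                           ≡⟨ cong₂ ℤ._+_ (ℤ.*-identityʳ (+ m)) (ℤ.*-identityʳ (+ n)) ⟨
    + m ℤ.* + 1 ℤ.+ + n ℤ.* + 1           ≡⟨ ℤ.*-identityʳ _ ⟨
    (+ m ℤ.* + 1 ℤ.+ + n ℤ.* + 1) ℤ.* + 1 ∎)))
  (fromℚᵘ-homo-+ (ℚᵘ.mkℚᵘ (+ m) 0) (ℚᵘ.mkℚᵘ (+ n) 0))
  where open ≡-Reasoning

fromℕ-* : ∀ m n → fromℕ (m ℕ.* n) ≡ fromℕ m * fromℕ n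
fromℕ-* m n = trans
  (fromℚᵘ-cong {ℚᵘ.mkℚᵘ (+ (m ℕ.* n)) 0} {ℚᵘ.mkℚᵘ (+ m) 0 ℚᵘ.* ℚᵘ.mkℚᵘ (+ n) 0} (ℚᵘ.*≡* (begin
    + (m ℕ.* n) ℤ.* + 1                   ≡⟨ ℤ.*-identityʳ _ ⟩
    + (m ℕ.* n)                           ≡⟨ ℤ.pos-* m n ⟩
    + m ℤ.* + n                           ≡⟨ ℤ.*-identityʳ _ ⟨
    (+ m ℤ.* + n) ℤ.* + 1                 ∎)))
  (fromℚᵘ-homo-* (ℚᵘ.mkℚᵘ (+ m) 0) (ℚᵘ.mkℚᵘ (+ n) 0))
  where open ≡-Reasoning

fromℕ-suc : ∀ n → fromℕ (suc n) ≡ fromℕ n + 1ℚ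
fromℕ-suc n = trans (fromℕ-+ 1 n) (+-comm 1ℚ (fromℕ n))

fromℕ-∸ : ∀ {m n} → n ≤ m → fromℕ (m ∸ n) ≡ fromℕ m - fromℕ n
fromℕ-∸ {m} {n} n≤m = begin
  fromℕ (m ∸ n)                           ≡⟨ add-sub (fromℕ (m ∸ n)) (fromℕ n) ⟨
  (fromℕ (m ∸ n) + fromℕ n) - fromℕ n     ≡⟨ cong (_- fromℕ n) (fromℕ-+ (m ∸ n) n) ⟨
  fromℕ (m ∸ n ℕ.+ n) - fromℕ n           ≡⟨ cong (λ k → fromℕ k - fromℕ n) (ℕ.m∸n+n≡m n≤m) ⟩
  fromℕ m - fromℕ n                       ∎
  where
  open ≡-Reasoning
  add-sub : ∀ p q → (p + q) - q ≡ p
  add-sub = solve-∀ ℚ-ring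

n/d≡n*1/d : ∀ n d .{{_ : NonZero d}} → + n / d ≡ fromℕ n * 1/ℕ d
n/d≡n*1/d n (suc d) = trans
  (fromℚᵘ-cong {ℚᵘ.mkℚᵘ (+ n) d} {ℚᵘ.mkℚᵘ (+ n) 0 ℚᵘ.* ℚᵘ.mkℚᵘ (+ 1) d} (ℚᵘ.*≡* (begin
    + n ℤ.* + (1 ℕ.* suc d)               ≡⟨ cong (λ k → + n ℤ.* + k) (ℕ.*-identityˡ (suc d)) ⟩
    + n ℤ.* + suc d                       ≡⟨ cong (ℤ._* + suc d) (ℤ.*-identityʳ (+ n)) ⟨
    (+ n ℤ.* + 1) ℤ.* + suc d             ∎)))
  (fromℚᵘ-homo-* (ℚᵘ.mkℚᵘ (+ n) 0) (ℚᵘ.mkℚᵘ (+ 1) d))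
  where open ≡-Reasoning

1/ℕ-inverseˡ : ∀ n .{{_ : NonZero n}} → 1/ℕ n * fromℕ n ≡ 1ℚ
1/ℕ-inverseˡ (suc d) = trans
  (sym (fromℚᵘ-homo-* (ℚᵘ.mkℚᵘ (+ 1) d) (ℚᵘ.mkℚᵘ (+ suc d) 0)))
  (fromℚᵘ-cong {ℚᵘ.mkℚᵘ (+ 1) d ℚᵘ.* ℚᵘ.mkℚᵘ (+ suc d) 0} {ℚᵘ.mkℚᵘ (+ 1) 0} (ℚᵘ.*≡* (begin
    (+ 1 ℤ.* + suc d) ℤ.* + 1             ≡⟨ ℤ.*-identityʳ _ ⟩
    + 1 ℤ.* + suc d                       ≡⟨ ℤ.*-identityˡ _ ⟩
    + suc d                               ≡⟨ cong +_ (ℕ.*-identityʳ (suc d)) ⟨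
    + (suc d ℕ.* 1)                       ≡⟨ ℤ.*-identityˡ _ ⟨
    + 1 ℤ.* + (suc d ℕ.* 1)               ∎)))
  where open ≡-Reasoning

*-cancelˡ-≡ : ∀ p {x y} .{{_ : ℚ.NonZero p}} → p * x ≡ p * y → x ≡ y
*-cancelˡ-≡ p {x} {y} eq = begin
  x                ≡⟨ *-identityˡ x ⟨
  1ℚ * x           ≡⟨ cong (_* x) (*-inverseˡ p) ⟨
  1/ p * p * x     ≡⟨ *-assoc (1/ p) p x ⟩
  1/ p * (p * x)   ≡⟨ cong (1/ p *_) eq ⟩
  1/ p * (p * y)   ≡⟨ *-assoc (1/ p) p y ⟨
  1/ p * p * y     ≡⟨ cong (_* y) (*-inverseˡ p) ⟩
  1ℚ * y           ≡⟨ *-identityˡ y ⟩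
  y                ∎
  where open ≡-Reasoning

ThreeTermRecurrence : ℕ → (b a c : ℕ → ℚ) → ℚ → (ℕ → ℚ) → Set
ThreeTermRecurrence D b a c θ f =
  ∀ i → 1 ≤ i → i < D → θ * f i ≡ (b i * f (suc i) + a i * f i) + c i * f (i ∸ 1)

three-term-unique : ∀ {D b a c θ f g} → (∀ i → 1 ≤ i → i < D → ℚ.NonZero (b i)) →
                    ThreeTermRecurrence D b a c θ f → ThreeTermRecurrence D b a c θ g →
                    f 0 ≡ g 0 → f 1 ≡ g 1 → ∀ i → i ≤ D → f i ≡ g i
three-term-unique {D} {b} {a} {c} {θ} {f} {g} b≢0 rec-f rec-g f₀ f₁ = agree
  where
  consecutive : ∀ i → i < D → f i ≡ g i × f (suc i) ≡ g (suc i)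
  consecutive zero    _     = f₀ , f₁
  consecutive (suc i) 1+i<D =
    f[1+i] , *-cancelˡ-≡ (b (suc i)) {{b≢0 (suc i) (s≤s z≤n) 1+i<D}} (∙-cancelʳ _ _ _ (∙-cancelʳ _ _ _ same-rhs))
    where
    f[i] : f i ≡ g i
    f[i] = proj₁ (consecutive i (ℕ.<⇒≤ 1+i<D))
    f[1+i] : f (suc i) ≡ g (suc i)
    f[1+i] = proj₂ (consecutive i (ℕ.<⇒≤ 1+i<D))
    same-rhs : b (suc i) * f (suc (suc i)) + a (suc i) * g (suc i) + c (suc i) * g i
             ≡ b (suc i) * g (suc (suc i)) + a (suc i) * g (suc i) + c (suc i) * g i
    same-rhs = begin
      b (suc i) * f (suc (suc i)) + a (suc i) * g (suc i) + c (suc i) * g i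
        ≡⟨ cong₂ (λ p q → b (suc i) * f (suc (suc i)) + a (suc i) * p + c (suc i) * q) f[1+i] f[i] ⟨
      b (suc i) * f (suc (suc i)) + a (suc i) * f (suc i) + c (suc i) * f i
        ≡⟨ rec-f (suc i) (s≤s z≤n) 1+i<D ⟨
      θ * f (suc i)
        ≡⟨ cong (θ *_) f[1+i] ⟩
      θ * g (suc i)
        ≡⟨ rec-g (suc i) (s≤s z≤n) 1+i<D ⟩
      b (suc i) * g (suc (suc i)) + a (suc i) * g (suc i) + c (suc i) * g i ∎
      where open ≡-Reasoning
  agree : ∀ i → i ≤ D → f i ≡ g i
  agree zero    _   = f₀
  agree (suc i) i<D = proj₂ (consecutive i i<D)

-- Pochhammer products and their contiguous relation

poch : ℚ → ℕ → ℚ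
poch y zero    = 1ℚ
poch y (suc n) = poch y n * (y + fromℕ n)

poch-suc-shift : ∀ y n → poch y (suc n) ≡ y * poch (y + 1ℚ) n
poch-suc-shift y zero    = identity y
  where
  identity : ∀ y → 1ℚ * (y + 0ℚ) ≡ y * 1ℚ
  identity = solve-∀ ℚ-ring
poch-suc-shift y (suc n) = begin
  poch y (suc n) * (y + fromℕ (suc n))              ≡⟨ cong₂ (λ p k → p * (y + k)) (poch-suc-shift y n) (fromℕ-suc n) ⟩
  y * poch (y + 1ℚ) n * (y + (fromℕ n + 1ℚ))         ≡⟨ identity y (poch (y + 1ℚ) n) (fromℕ n) ⟩
  y * (poch (y + 1ℚ) n * ((y + 1ℚ) + fromℕ n))       ∎
  where
  open ≡-Reasoning
  identity : ∀ y p k → y * p * (y + (k + 1ℚ)) ≡ y * (p * ((y + 1ℚ) + k))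
  identity = solve-∀ ℚ-ring

poch-root : ∀ {y t n} → t < n → y + fromℕ t ≡ 0ℚ → poch y n ≡ 0ℚ
poch-root {y} {t} {suc n} t<1+n root with ℕ.m<1+n⇒m<n∨m≡n t<1+n
... | inj₁ t<n  = trans (cong (_* (y + fromℕ n)) (poch-root t<n root)) (*-zeroˡ (y + fromℕ n))
... | inj₂ refl = trans (cong (poch y n *_) root) (*-zeroʳ (poch y n))

pochPair : ℚ → ℕ → ℚ
pochPair X n = poch (- X) n * poch (X + 1ℚ) n

pochPair-suc : ∀ X n → pochPair X (suc n) ≡ pochPair X n * (fromℕ n * (fromℕ n + 1ℚ) - X * (X + 1ℚ))
pochPair-suc X n = identity (poch (- X) n) (poch (X + 1ℚ) n) X (fromℕ n)
  where
  identity : ∀ p q X k → p * (- X + k) * (q * ((X + 1ℚ) + k)) ≡ p * q * (k * (k + 1ℚ) - X * (X + 1ℚ))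
  identity = solve-∀ ℚ-ring

pochPair-vanishes : ∀ {t n} → t < n → pochPair (fromℕ t) n ≡ 0ℚ
pochPair-vanishes {t} {n} t<n =
  trans (cong (_* poch (fromℕ t + 1ℚ) n) (poch-root t<n (+-inverseˡ (fromℕ t))))
        (*-zeroˡ (poch (fromℕ t + 1ℚ) n))

M : ℚ → ℚ
M d = d * (2ℚ + d)

commonDen : ℚ → ℚ → ℚ
commonDen d x = M d * (1ℚ + 2ℚ * x)

-- At d = D and x = i: b_i = bNum d x / commonDen d x, c_i = cNum d x / commonDen d x and
-- a_i = aNum x / M d.
bNum cNum : ℚ → ℚ → ℚ
bNum d x = 3ℚ * (d - x) * (x + 1ℚ) * (d + x + 2ℚ)
cNum d x = 3ℚ * ((d - x) + 1ℚ) * x * (d + x + 1ℚ)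

aNum : ℚ → ℚ
aNum x = 3ℚ * x * (x + 1ℚ)

ρ : ℚ → ℚ → ℚ
ρ d n = (1ℚ + n) * (1ℚ + n) * ((d - n) * (2ℚ + d + n))

pochPair-contiguous : ∀ d x n →
    (bNum d x * pochPair (x + 1ℚ) (suc n) + aNum x * (1ℚ + 2ℚ * x) * pochPair x (suc n))
      + cNum d x * pochPair (x - 1ℚ) (suc n)
  ≡ (3ℚ * commonDen d x - 6ℚ * ((fromℕ n + 1ℚ) * (fromℕ n + 2ℚ)) * (1ℚ + 2ℚ * x)) * pochPair x (suc n)
      - 6ℚ * (1ℚ + 2ℚ * x) * ρ d (fromℕ n) * pochPair x n
pochPair-contiguous d x zero = identity d x
  where
  identity : ∀ d x →
      (3ℚ * (d - x) * (x + 1ℚ) * (d + x + 2ℚ) * ((1ℚ * (- (x + 1ℚ) + 0ℚ)) * (1ℚ * (((x + 1ℚ) + 1ℚ) + 0ℚ)))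
        + 3ℚ * x * (x + 1ℚ) * (1ℚ + 2ℚ * x) * ((1ℚ * (- x + 0ℚ)) * (1ℚ * ((x + 1ℚ) + 0ℚ))))
        + 3ℚ * ((d - x) + 1ℚ) * x * (d + x + 1ℚ) * ((1ℚ * (- (x - 1ℚ) + 0ℚ)) * (1ℚ * (((x - 1ℚ) + 1ℚ) + 0ℚ)))
    ≡ (3ℚ * (d * (2ℚ + d) * (1ℚ + 2ℚ * x)) - 6ℚ * ((0ℚ + 1ℚ) * (0ℚ + 2ℚ)) * (1ℚ + 2ℚ * x))
        * ((1ℚ * (- x + 0ℚ)) * (1ℚ * ((x + 1ℚ) + 0ℚ)))
      - 6ℚ * (1ℚ + 2ℚ * x) * ((1ℚ + 0ℚ) * (1ℚ + 0ℚ) * ((d - 0ℚ) * (2ℚ + d + 0ℚ))) * (1ℚ * 1ℚ)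
  identity = solve-∀ ℚ-ring
pochPair-contiguous d x (suc m) =
  from-factors
    (cong (_* poch ((x + 1ℚ) + 1ℚ) (suc (suc m)))
          (trans (poch-suc-suc-shift (- (x + 1ℚ)) m)
                 (cong (λ y → - (x + 1ℚ) * ((- (x + 1ℚ) + 1ℚ) * poch y m)) (base₊ x))))
    (cong₂ _*_ (poch-suc-shift (- x) (suc m)) (poch-suc-shift (x + 1ℚ) (suc m)))
    (cong₂ _*_ (cong (λ y → poch y m * (y + k) * (y + fromℕ (suc m))) (base₋ x))
               (trans (poch-suc-suc-shift ((x - 1ℚ) + 1ℚ) m)
                      (cong (λ y → ((x - 1ℚ) + 1ℚ) * ((((x - 1ℚ) + 1ℚ) + 1ℚ) * poch y m)) (base₋′ x))))
    (cong₂ _*_ (poch-suc-shift (- x) m) (poch-suc-shift (x + 1ℚ) m))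
  where
  -- All four Pochhammer products contain E₁ = (1 − x)_m and E₂ = (x + 2)_m; with these factored out, the
  -- relation is a polynomial identity.
  k = fromℕ m
  E₁ = poch (- x + 1ℚ) m
  E₂ = poch ((x + 1ℚ) + 1ℚ) m
  poch-suc-suc-shift : ∀ y n → poch y (suc (suc n)) ≡ y * ((y + 1ℚ) * poch ((y + 1ℚ) + 1ℚ) n)
  poch-suc-suc-shift y n = trans (poch-suc-shift y (suc n)) (cong (y *_) (poch-suc-shift (y + 1ℚ) n))
  base₊ : ∀ x → (- (x + 1ℚ) + 1ℚ) + 1ℚ ≡ - x + 1ℚ
  base₊ = solve-∀ ℚ-ring
  base₋ : ∀ x → - (x - 1ℚ) ≡ - x + 1ℚ
  base₋ = solve-∀ ℚ-ring
  base₋′ : ∀ x → (((x - 1ℚ) + 1ℚ) + 1ℚ) + 1ℚ ≡ (x + 1ℚ) + 1ℚ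
  base₋′ = solve-∀ ℚ-ring
  identity : ∀ d x k E₁ E₂ →
      (3ℚ * (d - x) * (x + 1ℚ) * (d + x + 2ℚ)
          * (- (x + 1ℚ) * ((- (x + 1ℚ) + 1ℚ) * E₁) * (E₂ * (((x + 1ℚ) + 1ℚ) + k) * (((x + 1ℚ) + 1ℚ) + (k + 1ℚ))))
        + 3ℚ * x * (x + 1ℚ) * (1ℚ + 2ℚ * x)
          * (- x * (E₁ * ((- x + 1ℚ) + k)) * ((x + 1ℚ) * (E₂ * (((x + 1ℚ) + 1ℚ) + k)))))
        + 3ℚ * ((d - x) + 1ℚ) * x * (d + x + 1ℚ)
          * (E₁ * (- x + 1ℚ + k) * (- x + 1ℚ + (k + 1ℚ)) * (((x - 1ℚ) + 1ℚ) * ((((x - 1ℚ) + 1ℚ) + 1ℚ) * E₂)))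
    ≡ (3ℚ * (d * (2ℚ + d) * (1ℚ + 2ℚ * x)) - 6ℚ * (((k + 1ℚ) + 1ℚ) * ((k + 1ℚ) + 2ℚ)) * (1ℚ + 2ℚ * x))
        * (- x * (E₁ * ((- x + 1ℚ) + k)) * ((x + 1ℚ) * (E₂ * (((x + 1ℚ) + 1ℚ) + k))))
      - 6ℚ * (1ℚ + 2ℚ * x) * ((1ℚ + (k + 1ℚ)) * (1ℚ + (k + 1ℚ)) * ((d - (k + 1ℚ)) * (2ℚ + d + (k + 1ℚ))))
        * (- x * E₁ * ((x + 1ℚ) * E₂))
  identity = solve-∀ ℚ-ring
  from-factors : ∀ {A₊ A₀ A₋ A₁} →
    A₊ ≡ - (x + 1ℚ) * ((- (x + 1ℚ) + 1ℚ) * E₁) * (E₂ * (((x + 1ℚ) + 1ℚ) + k) * (((x + 1ℚ) + 1ℚ) + fromℕ (suc m))) →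
    A₀ ≡ - x * (E₁ * ((- x + 1ℚ) + k)) * ((x + 1ℚ) * (E₂ * (((x + 1ℚ) + 1ℚ) + k))) →
    A₋ ≡ E₁ * (- x + 1ℚ + k) * (- x + 1ℚ + fromℕ (suc m)) * (((x - 1ℚ) + 1ℚ) * ((((x - 1ℚ) + 1ℚ) + 1ℚ) * E₂)) →
    A₁ ≡ - x * E₁ * ((x + 1ℚ) * E₂) →
    (bNum d x * A₊ + aNum x * (1ℚ + 2ℚ * x) * A₀) + cNum d x * A₋
      ≡ (3ℚ * commonDen d x - 6ℚ * ((fromℕ (suc m) + 1ℚ) * (fromℕ (suc m) + 2ℚ)) * (1ℚ + 2ℚ * x)) * A₀
        - 6ℚ * (1ℚ + 2ℚ * x) * ρ d (fromℕ (suc m)) * A₁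
  from-factors refl refl refl refl rewrite fromℕ-suc m = identity d x k E₁ E₂

-- The terminating hypergeometric sum

ρℕ : ℕ → ℕ → ℕ
ρℕ D n = suc n ℕ.* suc n ℕ.* ((D ∸ n) ℕ.* (2 ℕ.+ D ℕ.+ n))

fromℕ-ρℕ : ∀ {D n} → n ≤ D → fromℕ (ρℕ D n) ≡ ρ (fromℕ D) (fromℕ n)
fromℕ-ρℕ {D} {n} n≤D = begin
  fromℕ (suc n ℕ.* suc n ℕ.* ((D ∸ n) ℕ.* (2 ℕ.+ D ℕ.+ n)))
    ≡⟨ fromℕ-* (suc n ℕ.* suc n) ((D ∸ n) ℕ.* (2 ℕ.+ D ℕ.+ n)) ⟩
  fromℕ (suc n ℕ.* suc n) * fromℕ ((D ∸ n) ℕ.* (2 ℕ.+ D ℕ.+ n))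
    ≡⟨ cong₂ _*_ (fromℕ-* (suc n) (suc n)) (fromℕ-* (D ∸ n) (2 ℕ.+ D ℕ.+ n)) ⟩
  fromℕ (suc n) * fromℕ (suc n) * (fromℕ (D ∸ n) * fromℕ (2 ℕ.+ D ℕ.+ n))
    ≡⟨ cong₂ (λ k l → k * k * (fromℕ (D ∸ n) * l)) (fromℕ-+ 1 n) (fromℕ-+ (2 ℕ.+ D) n) ⟩
  (1ℚ + fromℕ n) * (1ℚ + fromℕ n) * (fromℕ (D ∸ n) * (fromℕ (2 ℕ.+ D) + fromℕ n))
    ≡⟨ cong₂ (λ k l → (1ℚ + fromℕ n) * (1ℚ + fromℕ n) * (k * (l + fromℕ n)))
             (fromℕ-∸ n≤D) (fromℕ-+ 2 D) ⟩
  ρ (fromℕ D) (fromℕ n) ∎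
  where open ≡-Reasoning

-- As ρℕ D D = 0 and 1/ℕ 0 = 0, weight D n = 0 for n > D; only n ≤ D enters the sum.
weight : ℕ → ℕ → ℚ
weight D zero    = 1ℚ
weight D (suc n) = - (weight D n * 1/ℕ (ρℕ D n))

weight-step : ∀ {D n} → n < D → weight D n ≡ - (weight D (suc n) * ρ (fromℕ D) (fromℕ n))
weight-step {D} {n} n<D = begin
  weight D n                               ≡⟨ *-identityʳ (weight D n) ⟨
  weight D n * 1ℚ                          ≡⟨ cong (weight D n *_) (1/ℕ-inverseˡ (ρℕ D n) {{ρℕ≢0}}) ⟨
  weight D n * (1/ℕ (ρℕ D n) * fromℕ (ρℕ D n))
    ≡⟨ regroup (weight D n) (1/ℕ (ρℕ D n)) (fromℕ (ρℕ D n)) ⟩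
  - (- (weight D n * 1/ℕ (ρℕ D n)) * fromℕ (ρℕ D n))
    ≡⟨ cong (λ r → - (weight D (suc n) * r)) (fromℕ-ρℕ (ℕ.<⇒≤ n<D)) ⟩
  - (weight D (suc n) * ρ (fromℕ D) (fromℕ n)) ∎
  where
  open ≡-Reasoning
  ρℕ≢0 : NonZero (ρℕ D n)
  ρℕ≢0 = ℕ.m*n≢0 (suc n ℕ.* suc n) _ {{_}} {{ℕ.m*n≢0 (D ∸ n) _ {{ℕ.>-nonZero (ℕ.m<n⇒0<n∸m n<D)}}}}
  regroup : ∀ w r q → w * (r * q) ≡ - (- (w * r) * q)
  regroup = solve-∀ ℚ-ring

series : ℕ → ℕ → ℚ → ℚ → ℚ
series D zero    X Z = 0ℚ
series D (suc N) X Z = series D N X Z + weight D N * pochPair X N * pochPair Z N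

series-sym : ∀ D N X Z → series D N X Z ≡ series D N Z X
series-sym D zero    X Z = refl
series-sym D (suc N) X Z = cong₂ _+_ (series-sym D N X Z) (xy∙z≈xz∙y (weight D N) (pochPair X N) (pochPair Z N))

series-terminates : ∀ {D t N} Z → t < N → series D N (fromℕ t) Z ≡ series D (suc t) (fromℕ t) Z
series-terminates {D} {t} {suc N} Z t<1+N with ℕ.m<1+n⇒m<n∨m≡n t<1+N
... | inj₂ refl = refl
... | inj₁ t<N  = begin
  series D N (fromℕ t) Z + weight D N * pochPair (fromℕ t) N * pochPair Z N
    ≡⟨ cong (λ p → series D N (fromℕ t) Z + weight D N * p * pochPair Z N) (pochPair-vanishes t<N) ⟩
  series D N (fromℕ t) Z + weight D N * 0ℚ * pochPair Z N
    ≡⟨ drop (series D N (fromℕ t) Z) (weight D N) (pochPair Z N) ⟩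
  series D N (fromℕ t) Z
    ≡⟨ series-terminates Z t<N ⟩
  series D (suc t) (fromℕ t) Z ∎
  where
  open ≡-Reasoning
  drop : ∀ s w p → s + w * 0ℚ * p ≡ s
  drop = solve-∀ ℚ-ring

-- Multiplied by the common denominator D(D+2)(2x+1), the recurrence at i = x and λ = θ_z reads
-- eigenvalue · g(x) = L g, for g a function of i.
module Contiguity (D : ℕ) (x z : ℚ) where

  private
    d = fromℕ D
    κ = 6ℚ * (1ℚ + 2ℚ * x)

  L : (ℚ → ℚ) → ℚ
  L g = (bNum d x * g (x + 1ℚ) + aNum x * (1ℚ + 2ℚ * x) * g x) + cNum d x * g (x - 1ℚ)

  eigenvalue : ℚ
  eigenvalue = (1ℚ + 2ℚ * x) * (3ℚ * M d - 2ℚ * aNum z)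

  boundary : ℕ → ℚ
  boundary zero    = 0ℚ
  boundary (suc n) = weight D n * pochPair x n * pochPair z (suc n)

  L-summand : ∀ n → n ≤ D →
    weight D n * pochPair z n * L (λ X → pochPair X n)
      ≡ eigenvalue * (weight D n * pochPair x n * pochPair z n) - κ * (boundary (suc n) - boundary n)
  L-summand zero    _   = identity d x z
    where
    identity : ∀ d x z →
        1ℚ * (1ℚ * 1ℚ)
          * ((3ℚ * (d - x) * (x + 1ℚ) * (d + x + 2ℚ) * (1ℚ * 1ℚ) + 3ℚ * x * (x + 1ℚ) * (1ℚ + 2ℚ * x) * (1ℚ * 1ℚ))
              + 3ℚ * ((d - x) + 1ℚ) * x * (d + x + 1ℚ) * (1ℚ * 1ℚ))
      ≡ (1ℚ + 2ℚ * x) * (3ℚ * (d * (2ℚ + d)) - 2ℚ * (3ℚ * z * (z + 1ℚ))) * (1ℚ * (1ℚ * 1ℚ) * (1ℚ * 1ℚ))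
        - 6ℚ * (1ℚ + 2ℚ * x) * (1ℚ * (1ℚ * 1ℚ) * ((1ℚ * (- z + 0ℚ)) * (1ℚ * ((z + 1ℚ) + 0ℚ))) - 0ℚ)
    identity = solve-∀ ℚ-ring
  L-summand (suc m) m<D = begin
    w₁ * Az₁ * L (λ X → pochPair X (suc m))
      ≡⟨ cong (w₁ * Az₁ *_) (pochPair-contiguous d x m) ⟩
    w₁ * Az₁ * ((3ℚ * commonDen d x - 6ℚ * ((k + 1ℚ) * (k + 2ℚ)) * (1ℚ + 2ℚ * x)) * A₁ - κ * ρ d k * A₀)
      ≡⟨ identity d x z k w₁ Az₁ A₁ A₀ ⟩
    eigenvalue * (w₁ * A₁ * Az₁)
      - κ * (w₁ * A₁ * (Az₁ * ((k + 1ℚ) * ((k + 1ℚ) + 1ℚ) - z * (z + 1ℚ))) - - (w₁ * ρ d k) * A₀ * Az₁)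
      ≡⟨ cong₂ (λ a w → eigenvalue * (w₁ * A₁ * Az₁) - κ * (w₁ * A₁ * a - w * A₀ * Az₁))
               Az₂-factors (weight-step m<D) ⟨
    eigenvalue * (w₁ * A₁ * Az₁) - κ * (boundary (suc (suc m)) - boundary (suc m)) ∎
    where
    open ≡-Reasoning
    k = fromℕ m
    w₁ = weight D (suc m)
    Az₁ = pochPair z (suc m)
    A₁ = pochPair x (suc m)
    A₀ = pochPair x m
    Az₂-factors : pochPair z (suc (suc m)) ≡ Az₁ * ((k + 1ℚ) * ((k + 1ℚ) + 1ℚ) - z * (z + 1ℚ))
    Az₂-factors = trans (pochPair-suc z (suc m))
                        (cong (λ k′ → Az₁ * (k′ * (k′ + 1ℚ) - z * (z + 1ℚ))) (fromℕ-suc m))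
    identity : ∀ d x z k w₁ Az₁ A₁ A₀ →
        w₁ * Az₁ * ((3ℚ * (d * (2ℚ + d) * (1ℚ + 2ℚ * x)) - 6ℚ * ((k + 1ℚ) * (k + 2ℚ)) * (1ℚ + 2ℚ * x)) * A₁
                    - 6ℚ * (1ℚ + 2ℚ * x) * ((1ℚ + k) * (1ℚ + k) * ((d - k) * (2ℚ + d + k))) * A₀)
      ≡ (1ℚ + 2ℚ * x) * (3ℚ * (d * (2ℚ + d)) - 2ℚ * (3ℚ * z * (z + 1ℚ))) * (w₁ * A₁ * Az₁)
        - 6ℚ * (1ℚ + 2ℚ * x) * (w₁ * A₁ * (Az₁ * ((k + 1ℚ) * ((k + 1ℚ) + 1ℚ) - z * (z + 1ℚ)))
                                - - (w₁ * ((1ℚ + k) * (1ℚ + k) * ((d - k) * (2ℚ + d + k)))) * A₀ * Az₁)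
    identity = solve-∀ ℚ-ring

  L-series : ∀ N → N ≤ suc D → L (λ X → series D N X z) ≡ eigenvalue * series D N x z - κ * boundary N
  L-series zero    _       = identity (bNum d x) (aNum x * (1ℚ + 2ℚ * x)) (cNum d x) eigenvalue κ
    where
    identity : ∀ b a c e κ → (b * 0ℚ + a * 0ℚ) + c * 0ℚ ≡ e * 0ℚ - κ * 0ℚ
    identity = solve-∀ ℚ-ring
  L-series (suc N) N<1+D = begin
    L (λ X → series D (suc N) X z)
      ≡⟨ regroup (bNum d x) (aNum x * (1ℚ + 2ℚ * x)) (cNum d x) (S (x + 1ℚ)) (S x) (S (x - 1ℚ))
                 (weight D N) (pochPair z N) (pochPair (x + 1ℚ) N) (pochPair x N) (pochPair (x - 1ℚ) N) ⟩
    L (λ X → series D N X z) + weight D N * pochPair z N * L (λ X → pochPair X N)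
      ≡⟨ cong₂ _+_ (L-series N (ℕ.<⇒≤ N<1+D)) (L-summand N (ℕ.≤-pred N<1+D)) ⟩
    (eigenvalue * S x - κ * boundary N) + (eigenvalue * t - κ * (boundary (suc N) - boundary N))
      ≡⟨ collect eigenvalue κ (S x) t (boundary N) (boundary (suc N)) ⟩
    eigenvalue * series D (suc N) x z - κ * boundary (suc N) ∎
    where
    open ≡-Reasoning
    S : ℚ → ℚ
    S X = series D N X z
    t = weight D N * pochPair x N * pochPair z N
    regroup : ∀ b a c s₊ s₀ s₋ w v p₊ p₀ p₋ →
      (b * (s₊ + w * p₊ * v) + a * (s₀ + w * p₀ * v)) + c * (s₋ + w * p₋ * v)
        ≡ ((b * s₊ + a * s₀) + c * s₋) + w * v * ((b * p₊ + a * p₀) + c * p₋)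
    regroup = solve-∀ ℚ-ring
    collect : ∀ e κ s t B B′ → (e * s - κ * B) + (e * t - κ * (B′ - B)) ≡ e * (s + t) - κ * B′
    collect = solve-∀ ℚ-ring

  L-series-terminating : pochPair z (suc D) ≡ 0ℚ →
    L (λ X → series D (suc D) X z) ≡ eigenvalue * series D (suc D) x z
  L-series-terminating vanishes = begin
    L (λ X → series D (suc D) X z)
      ≡⟨ L-series (suc D) ℕ.≤-refl ⟩
    eigenvalue * series D (suc D) x z - κ * (weight D D * pochPair x D * pochPair z (suc D))
      ≡⟨ cong (λ p → eigenvalue * series D (suc D) x z - κ * (weight D D * pochPair x D * p)) vanishes ⟩
    eigenvalue * series D (suc D) x z - κ * (weight D D * pochPair x D * 0ℚ)
      ≡⟨ drop (eigenvalue * series D (suc D) x z) κ (weight D D * pochPair x D) ⟩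
    eigenvalue * series D (suc D) x z ∎
    where
    open ≡-Reasoning
    drop : ∀ s κ w → s - κ * (w * 0ℚ) ≡ s
    drop = solve-∀ ℚ-ring

fromℕ-M : ∀ D → fromℕ (D ℕ.* (2 ℕ.+ D)) ≡ M (fromℕ D)
fromℕ-M D = trans (fromℕ-* D (2 ℕ.+ D)) (cong (fromℕ D *_) (fromℕ-+ 2 D))

fromℕ-den : ∀ D i .{{_ : NonZero D}} → fromℕ (den D i) ≡ commonDen (fromℕ D) (fromℕ i)
fromℕ-den D i = trans (fromℕ-* (D ℕ.* (2 ℕ.+ D)) (suc (2 ℕ.* i)))
  (cong₂ _*_ (fromℕ-M D) (trans (fromℕ-+ 1 (2 ℕ.* i)) (cong (λ p → 1ℚ + p) (fromℕ-* 2 i))))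

fromℕ-aNum : ∀ i → fromℕ (3 ℕ.* i ℕ.* (i ℕ.+ 1)) ≡ aNum (fromℕ i)
fromℕ-aNum i = trans (fromℕ-* (3 ℕ.* i) (i ℕ.+ 1)) (cong₂ _*_ (fromℕ-* 3 i) (fromℕ-+ i 1))

fromℕ-bNum : ∀ {D i} → i ≤ D →
             fromℕ (3 ℕ.* (D ∸ i) ℕ.* (i ℕ.+ 1) ℕ.* (D ℕ.+ i ℕ.+ 2)) ≡ bNum (fromℕ D) (fromℕ i)
fromℕ-bNum {D} {i} i≤D = begin
  fromℕ (3 ℕ.* (D ∸ i) ℕ.* (i ℕ.+ 1) ℕ.* (D ℕ.+ i ℕ.+ 2))
    ≡⟨ fromℕ-* (3 ℕ.* (D ∸ i) ℕ.* (i ℕ.+ 1)) (D ℕ.+ i ℕ.+ 2) ⟩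
  fromℕ (3 ℕ.* (D ∸ i) ℕ.* (i ℕ.+ 1)) * fromℕ (D ℕ.+ i ℕ.+ 2)
    ≡⟨ cong₂ _*_ (fromℕ-* (3 ℕ.* (D ∸ i)) (i ℕ.+ 1)) (fromℕ-+ (D ℕ.+ i) 2) ⟩
  fromℕ (3 ℕ.* (D ∸ i)) * fromℕ (i ℕ.+ 1) * (fromℕ (D ℕ.+ i) + 2ℚ)
    ≡⟨ cong₂ (λ p q → p * fromℕ (i ℕ.+ 1) * (q + 2ℚ)) (fromℕ-* 3 (D ∸ i)) (fromℕ-+ D i) ⟩
  3ℚ * fromℕ (D ∸ i) * fromℕ (i ℕ.+ 1) * (fromℕ D + fromℕ i + 2ℚ)
    ≡⟨ cong₂ (λ p q → 3ℚ * p * q * (fromℕ D + fromℕ i + 2ℚ)) (fromℕ-∸ i≤D) (fromℕ-+ i 1) ⟩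
  bNum (fromℕ D) (fromℕ i) ∎
  where open ≡-Reasoning

fromℕ-cNum : ∀ {D i} → i ≤ D →
             fromℕ (3 ℕ.* ((D ∸ i) ℕ.+ 1) ℕ.* i ℕ.* (D ℕ.+ i ℕ.+ 1)) ≡ cNum (fromℕ D) (fromℕ i)
fromℕ-cNum {D} {i} i≤D = begin
  fromℕ (3 ℕ.* ((D ∸ i) ℕ.+ 1) ℕ.* i ℕ.* (D ℕ.+ i ℕ.+ 1))
    ≡⟨ fromℕ-* (3 ℕ.* ((D ∸ i) ℕ.+ 1) ℕ.* i) (D ℕ.+ i ℕ.+ 1) ⟩
  fromℕ (3 ℕ.* ((D ∸ i) ℕ.+ 1) ℕ.* i) * fromℕ (D ℕ.+ i ℕ.+ 1)
    ≡⟨ cong₂ _*_ (fromℕ-* (3 ℕ.* ((D ∸ i) ℕ.+ 1)) i) (fromℕ-+ (D ℕ.+ i) 1) ⟩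
  fromℕ (3 ℕ.* ((D ∸ i) ℕ.+ 1)) * fromℕ i * (fromℕ (D ℕ.+ i) + 1ℚ)
    ≡⟨ cong₂ (λ p q → p * fromℕ i * (q + 1ℚ)) (fromℕ-* 3 ((D ∸ i) ℕ.+ 1)) (fromℕ-+ D i) ⟩
  3ℚ * fromℕ ((D ∸ i) ℕ.+ 1) * fromℕ i * (fromℕ D + fromℕ i + 1ℚ)
    ≡⟨ cong (λ p → 3ℚ * p * fromℕ i * (fromℕ D + fromℕ i + 1ℚ))
            (trans (fromℕ-+ (D ∸ i) 1) (cong (_+ 1ℚ) (fromℕ-∸ i≤D))) ⟩
  cNum (fromℕ D) (fromℕ i) ∎
  where open ≡-Reasoning

closedForm : ℕ → ℕ → ℕ → ℚ
closedForm D i j = series D (suc D) (fromℕ i) (fromℕ j)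

closedForm-sym : ∀ D i j → closedForm D i j ≡ closedForm D j i
closedForm-sym D i j = series-sym D (suc D) (fromℕ i) (fromℕ j)

closedForm-zeroˡ : ∀ D j → closedForm D 0 j ≡ 1ℚ
closedForm-zeroˡ D j = series-terminates {D} {0} {suc D} (fromℕ j) (s≤s z≤n)

module _ (D : ℕ) .{{_ : NonZero D}} where

  private
    d = fromℕ D
    M≢0 : NonZero (D ℕ.* (2 ℕ.+ D))
    M≢0 = ℕ.m*n≢0 D (2 ℕ.+ D)

  1/M : ℚ
  1/M = 1/ℕ (D ℕ.* (2 ℕ.+ D))

  1/den : ℕ → ℚ
  1/den i = 1/ℕ (den D i)

  1/M-inverse : 1/M * M d ≡ 1ℚ
  1/M-inverse = trans (cong (1/M *_) (sym (fromℕ-M D))) (1/ℕ-inverseˡ (D ℕ.* (2 ℕ.+ D)) {{M≢0}})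

  1/den-inverse : ∀ i → 1/den i * commonDen d (fromℕ i) ≡ 1ℚ
  1/den-inverse i = trans (cong (1/den i *_) (sym (fromℕ-den D i))) (1/ℕ-inverseˡ (den D i) {{den≢0 D i}})

  1/M≡[1+2i]/den : ∀ i → 1/M ≡ (1ℚ + 2ℚ * fromℕ i) * 1/den i
  1/M≡[1+2i]/den i = begin
    1/M                                ≡⟨ *-identityʳ 1/M ⟨
    1/M * 1ℚ                           ≡⟨ cong (1/M *_) (1/den-inverse i) ⟨
    1/M * (Y * (M d * (1ℚ + 2ℚ * x)))  ≡⟨ regroup 1/M Y (M d) x ⟩
    1/M * M d * ((1ℚ + 2ℚ * x) * Y)    ≡⟨ cong (_* ((1ℚ + 2ℚ * x) * Y)) 1/M-inverse ⟩
    1ℚ * ((1ℚ + 2ℚ * x) * Y)           ≡⟨ *-identityˡ _ ⟩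
    (1ℚ + 2ℚ * x) * Y                  ∎
    where
    open ≡-Reasoning
    x = fromℕ i
    Y = 1/den i
    regroup : ∀ v y m x → v * (y * (m * (1ℚ + 2ℚ * x))) ≡ v * m * ((1ℚ + 2ℚ * x) * y)
    regroup = solve-∀ ℚ-ring

  a-factors : ∀ i → a D i ≡ aNum (fromℕ i) * 1/M
  a-factors i = trans (n/d≡n*1/d (3 ℕ.* i ℕ.* (i ℕ.+ 1)) (D ℕ.* (2 ℕ.+ D)) {{M≢0}}) (cong (_* 1/M) (fromℕ-aNum i))

  b-factors : ∀ {i} → i ≤ D → b D i ≡ bNum d (fromℕ i) * 1/den i
  b-factors {i} i≤D =
    trans (n/d≡n*1/d (3 ℕ.* (D ∸ i) ℕ.* (i ℕ.+ 1) ℕ.* (D ℕ.+ i ℕ.+ 2)) (den D i) {{den≢0 D i}})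
          (cong (_* 1/den i) (fromℕ-bNum i≤D))

  c-factors : ∀ {i} → i ≤ D → c D i ≡ cNum d (fromℕ i) * 1/den i
  c-factors {i} i≤D =
    trans (n/d≡n*1/d (3 ℕ.* ((D ∸ i) ℕ.+ 1) ℕ.* i ℕ.* (D ℕ.+ i ℕ.+ 1)) (den D i) {{den≢0 D i}})
          (cong (_* 1/den i) (fromℕ-cNum i≤D))

  b-nonZero : ∀ i → i < D → ℚ.NonZero (b D i)
  b-nonZero i i<D = pos⇒nonZero (b D i) {{normalize-pos numerator (den D i) {{den≢0 D i}} {{numerator≢0}}}}
    where
    numerator = 3 ℕ.* (D ∸ i) ℕ.* (i ℕ.+ 1) ℕ.* (D ℕ.+ i ℕ.+ 2)
    instance
      D∸i≢0 : NonZero (D ∸ i)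
      D∸i≢0 = ℕ.>-nonZero (ℕ.m<n⇒0<n∸m i<D)
      i+1≢0 : NonZero (i ℕ.+ 1)
      i+1≢0 = ℕ.≢-nonZero (ℕ.m+1+n≢0 i)
      D+i+2≢0 : NonZero (D ℕ.+ i ℕ.+ 2)
      D+i+2≢0 = ℕ.≢-nonZero (ℕ.m+1+n≢0 (D ℕ.+ i))
    numerator≢0 : NonZero numerator
    numerator≢0 = ℕ.m*n≢0 (3 ℕ.* (D ∸ i) ℕ.* (i ℕ.+ 1)) (D ℕ.+ i ℕ.+ 2)
                    {{ℕ.m*n≢0 (3 ℕ.* (D ∸ i)) (i ℕ.+ 1) {{ℕ.m*n≢0 3 (D ∸ i)}}}}

  θ≡eigenvalue/den : ∀ i j → θ D j ≡ 1/den i * Contiguity.eigenvalue D (fromℕ i) (fromℕ j)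
  θ≡eigenvalue/den i j = begin
    3ℚ - 2ℚ * a D j
      ≡⟨ cong (λ p → 3ℚ - 2ℚ * p) (a-factors j) ⟩
    3ℚ - 2ℚ * (aNum z * 1/M)
      ≡⟨ cong₂ (λ p q → p - 2ℚ * (aNum z * q)) (sym (*-identityʳ 3ℚ)) (1/M≡[1+2i]/den i) ⟩
    3ℚ * 1ℚ - 2ℚ * (aNum z * ((1ℚ + 2ℚ * x) * Y))
      ≡⟨ cong (λ p → 3ℚ * p - 2ℚ * (aNum z * ((1ℚ + 2ℚ * x) * Y))) (1/den-inverse i) ⟨
    3ℚ * (Y * commonDen d x) - 2ℚ * (aNum z * ((1ℚ + 2ℚ * x) * Y))
      ≡⟨ regroup Y x (M d) (aNum z) ⟩
    Y * ((1ℚ + 2ℚ * x) * (3ℚ * M d - 2ℚ * aNum z)) ∎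
    where
    open ≡-Reasoning
    x = fromℕ i
    z = fromℕ j
    Y = 1/den i
    regroup : ∀ y x m a → 3ℚ * (y * (m * (1ℚ + 2ℚ * x))) - 2ℚ * (a * ((1ℚ + 2ℚ * x) * y))
                          ≡ y * ((1ℚ + 2ℚ * x) * (3ℚ * m - 2ℚ * a))
    regroup = solve-∀ ℚ-ring

  weight-one : weight D 1 ≡ - 1/M
  weight-one = begin
    w₁
      ≡⟨ identity w₁ 1/M d ⟩
    - 1/M * - (w₁ * ρ d 0ℚ) + w₁ * (1ℚ - 1/M * M d)
      ≡⟨ cong₂ (λ p q → - 1/M * p + w₁ * (1ℚ - q)) (sym (weight-step (ℕ.>-nonZero⁻¹ D))) 1/M-inverse ⟩
    - 1/M * 1ℚ + w₁ * (1ℚ - 1ℚ)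
      ≡⟨ simplify 1/M w₁ ⟩
    - 1/M ∎
    where
    open ≡-Reasoning
    w₁ = weight D 1
    identity : ∀ w v d →
      w ≡ - v * - (w * ((1ℚ + 0ℚ) * (1ℚ + 0ℚ) * ((d - 0ℚ) * (2ℚ + d + 0ℚ)))) + w * (1ℚ - v * (d * (2ℚ + d)))
    identity = solve-∀ ℚ-ring
    simplify : ∀ v w → - v * 1ℚ + w * (1ℚ - 1ℚ) ≡ - v
    simplify = solve-∀ ℚ-ring

  closedForm-oneˡ : ∀ j → closedForm D 1 j ≡ θ D j * (+ 1 / 3)
  closedForm-oneˡ j = begin
    closedForm D 1 j
      ≡⟨ series-terminates {D} {1} {suc D} z (s≤s (ℕ.>-nonZero⁻¹ D)) ⟩
    series D 2 1ℚ z
      ≡⟨ cong (λ w → (0ℚ + 1ℚ * (1ℚ * 1ℚ) * (1ℚ * 1ℚ)) + w * pochPair 1ℚ 1 * pochPair z 1) weight-one ⟩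
    (0ℚ + 1ℚ * (1ℚ * 1ℚ) * (1ℚ * 1ℚ)) + - 1/M * pochPair 1ℚ 1 * pochPair z 1
      ≡⟨ identity z 1/M ⟩
    (3ℚ - 2ℚ * (aNum z * 1/M)) * (+ 1 / 3)
      ≡⟨ cong (λ p → (3ℚ - 2ℚ * p) * (+ 1 / 3)) (a-factors j) ⟨
    θ D j * (+ 1 / 3) ∎
    where
    open ≡-Reasoning
    z = fromℕ j
    identity : ∀ z v →
        (0ℚ + 1ℚ * (1ℚ * 1ℚ) * (1ℚ * 1ℚ))
          + - v * ((1ℚ * (- 1ℚ + 0ℚ)) * (1ℚ * ((1ℚ + 1ℚ) + 0ℚ))) * ((1ℚ * (- z + 0ℚ)) * (1ℚ * ((z + 1ℚ) + 0ℚ)))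
      ≡ (3ℚ - 2ℚ * (3ℚ * z * (z + 1ℚ) * v)) * (+ 1 / 3)
    identity = solve-∀ ℚ-ring

  closedForm-cleared : ∀ i j → j ≤ D →
    let x = fromℕ (suc i) in
    (bNum d x * closedForm D (suc (suc i)) j + aNum x * (1ℚ + 2ℚ * x) * closedForm D (suc i) j)
      + cNum d x * closedForm D i j
    ≡ Contiguity.eigenvalue D x (fromℕ j) * closedForm D (suc i) j
  closedForm-cleared i j j≤D =
    trans (cong₂ (λ p q → (bNum d x * S p + aNum x * (1ℚ + 2ℚ * x) * S x) + cNum d x * S q)
                 (fromℕ-suc (suc i)) (trans (sym (add-sub (fromℕ i))) (cong (_- 1ℚ) (sym (fromℕ-suc i)))))
          (Contiguity.L-series-terminating D x z (pochPair-vanishes (s≤s j≤D)))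
    where
    x = fromℕ (suc i)
    z = fromℕ j
    S : ℚ → ℚ
    S X = series D (suc D) X z
    add-sub : ∀ p → (p + 1ℚ) - 1ℚ ≡ p
    add-sub = solve-∀ ℚ-ring

  closedForm-recurrence : ∀ i j → 1 ≤ i → i < D → j ≤ D →
    θ D j * closedForm D i j
      ≡ (b D i * closedForm D (suc i) j + a D i * closedForm D i j) + c D i * closedForm D (i ∸ 1) j
  closedForm-recurrence (suc i) j _ 1+i<D j≤D = begin
    θ D j * F₀
      ≡⟨ cong (_* F₀) (θ≡eigenvalue/den (suc i) j) ⟩
    Y * eigenvalue * F₀
      ≡⟨ *-assoc Y eigenvalue F₀ ⟩
    Y * (eigenvalue * F₀)
      ≡⟨ cong (Y *_) (closedForm-cleared i j j≤D) ⟨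
    Y * ((bNum d x * F₊ + aNum x * (1ℚ + 2ℚ * x) * F₀) + cNum d x * F₋)
      ≡⟨ distribute (bNum d x) (aNum x) (cNum d x) x Y F₊ F₀ F₋ ⟩
    (bNum d x * Y * F₊ + aNum x * ((1ℚ + 2ℚ * x) * Y) * F₀) + cNum d x * Y * F₋
      ≡⟨ coefficients (b-factors 1+i≤D) (trans (a-factors (suc i)) (cong (aNum x *_) (1/M≡[1+2i]/den (suc i))))
                      (c-factors 1+i≤D) ⟨
    (b D (suc i) * F₊ + a D (suc i) * F₀) + c D (suc i) * F₋ ∎
    where
    open ≡-Reasoning
    open Contiguity D (fromℕ (suc i)) (fromℕ j) using (eigenvalue)
    x = fromℕ (suc i)
    Y = 1/den (suc i)
    F₊ = closedForm D (suc (suc i)) j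
    F₀ = closedForm D (suc i) j
    F₋ = closedForm D i j
    1+i≤D : suc i ≤ D
    1+i≤D = ℕ.<⇒≤ 1+i<D
    coefficients : ∀ {p p′ q q′ r r′} → p ≡ p′ → q ≡ q′ → r ≡ r′ →
                   (p * F₊ + q * F₀) + r * F₋ ≡ (p′ * F₊ + q′ * F₀) + r′ * F₋
    coefficients refl refl refl = refl
    distribute : ∀ b a c x y F₊ F₀ F₋ →
      y * ((b * F₊ + a * (1ℚ + 2ℚ * x) * F₀) + c * F₋)
        ≡ (b * y * F₊ + a * ((1ℚ + 2ℚ * x) * y) * F₀) + c * y * F₋
    distribute = solve-∀ ℚ-ring

lemma3p2 : (D : ℕ) → .{{_ : NonZero D}} → (u : ℕ → ℚ → ℚ)
           → (∀ x → u 0 x ≡ 1ℚ)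
           → (∀ x → u 1 x ≡ x * (+ 1 / 3))
           → (∀ i x → 1 ≤ i → i ≤ D ∸ 1
                → x * u i x ≡ (b D i * u (suc i) x + a D i * u i x) + c D i * u (i ∸ 1) x)
           → ((∀ i j → i ≤ D → j ≤ D → u i (θ D j) ≡ u j (θ D i))
              × (∀ i → i ≤ D → u i (θ D 0) ≡ 1ℚ)
              × (∀ j → j ≤ D → u 0 (θ D j) ≡ 1ℚ))
lemma3p2 D@(suc _) u u₀ u₁ recurrence = symmetric , at-θ₀ , λ j _ → u₀ (θ D j)
  where
  u≡closedForm : ∀ i j → i ≤ D → j ≤ D → u i (θ D j) ≡ closedForm D i j
  u≡closedForm i j i≤D j≤D =
    three-term-unique {b = b D} {a D} {c D} {θ D j} {λ k → u k (θ D j)} {λ k → closedForm D k j}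
      (λ k _ → b-nonZero D k)
      (λ k 1≤k k<D → recurrence k (θ D j) 1≤k (s≤s⁻¹ k<D))
      (λ k 1≤k k<D → closedForm-recurrence D k j 1≤k k<D j≤D)
      (trans (u₀ (θ D j)) (sym (closedForm-zeroˡ D j)))
      (trans (u₁ (θ D j)) (sym (closedForm-oneˡ D j)))
      i i≤D
  symmetric : ∀ i j → i ≤ D → j ≤ D → u i (θ D j) ≡ u j (θ D i)
  symmetric i j i≤D j≤D =
    trans (u≡closedForm i j i≤D j≤D) (trans (closedForm-sym D i j) (sym (u≡closedForm j i j≤D i≤D)))
  at-θ₀ : ∀ i → i ≤ D → u i (θ D 0) ≡ 1ℚ
  at-θ₀ i i≤D = trans (u≡closedForm i 0 i≤D z≤n) (trans (closedForm-sym D i 0) (closedForm-zeroˡ D i))
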